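{- Let $A,B,C$ be finite filiform games, let $\sigma$ be a strategy on $A\multimap B$ and $\tau$ a strategy on $B\multimap C$. Let $\tau\circ\sigma$ be the relation on $M_A\uplus M_C$ obtained by restricting to $M_A\uplus M_C$ the transitive closure of $\le_\sigma\cup\le_\tau$ on $M_A\uplus M_B\uplus M_C$. Then $\tau\circ\sigma$ is a strategy on $A\multimap C$ (in particular it satisfies the acyclicity property).
   Context: A game $A=(M_A,\lambda_A,\le_A)$ consists of a set of moves $M_A$, a polarity function $\lambda_A:M_A\to\{ -1,+1\}$ ($+1$ Proponent, $-1$ Opponent) and a well-founded partial order $\le_A$ on $M_A$. $A^*$ is $A$ with polarities inverted; $A\otimes B$ is the disjoint union of moves, polarities and orders; $A\multimap B=A^*\otimes B$. A game is filiform if $\le_A$ is a total order, and finite if $M_A$ is finite. A strategy on a game $A$ is a partial order $\le_\sigma$ on $M_A$ such that (polarity) $m<_\sigma n$ implies $\lambda_A(m)=-1$ and $\lambda_A(n)=+1$, and (acyclicity) the transitive closure of $\le_\sigma\cup\le_A$ is a partial order. -}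

module Defs where

open import Level using (0ℓ)
open import Data.Nat using (ℕ)
open import Data.Fin using (Fin)
open import Data.Empty using (⊥)
open import Data.Product using (Σ; _×_; ∃; ∃₂)
open import Data.Sum using (_⊎_; inj₁; inj₂)
open import Function.Bundles using (_↔_)
open import Relation.Nullary using (¬_)
open import Relation.Binary.Core using (Rel)
open import Relation.Binary.Definitions using (Total)
open import Relation.Binary.Structures using (IsPartialOrder)
open import Relation.Binary.PropositionalEquality using (_≡_)
open import Relation.Binary.Construct.Closure.Transitive using (TransClosure)
open import Induction.WellFounded using (WellFounded)

-- Polarities: O = Opponent (-1), P = Proponent (+1)
data Pol : Set where
  O P : Pol

neg : Pol → Pol
neg O = P
neg P = O

record Game : Set₁ where
  field
    M   : Set
    pol : M → Pol
    _≤_ : Rel M 0ℓ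

open Game public

Strict : {X : Set} → Rel X 0ℓ → Rel X 0ℓ
Strict R x y = R x y × ¬ (x ≡ y)

IsGame : Game → Set
IsGame A = IsPartialOrder _≡_ (_≤_ A) × WellFounded (Strict (_≤_ A))

Filiform : Game → Set
Filiform A = Total (_≤_ A)

Finite : Game → Set
Finite A = Σ ℕ λ n → M A ↔ Fin n

_⊎ʳ_ : {X Y : Set} → Rel X 0ℓ → Rel Y 0ℓ → Rel (X ⊎ Y) 0ℓ
(R ⊎ʳ S) (inj₁ x) (inj₁ x') = R x x'
(R ⊎ʳ S) (inj₁ x) (inj₂ y') = ⊥
(R ⊎ʳ S) (inj₂ y) (inj₁ x') = ⊥
(R ⊎ʳ S) (inj₂ y) (inj₂ y') = S y y'

[_,_]ᵖ : {X Y : Set} → (X → Pol) → (Y → Pol) → X ⊎ Y → Pol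
[ f , g ]ᵖ (inj₁ x) = f x
[ f , g ]ᵖ (inj₂ y) = g y

_* : Game → Game
A * = record { M = M A ; pol = λ m → neg (pol A m) ; _≤_ = _≤_ A }

_⊗_ : Game → Game → Game
A ⊗ B = record { M = M A ⊎ M B ; pol = [ pol A , pol B ]ᵖ ; _≤_ = _≤_ A ⊎ʳ _≤_ B }

_⊸_ : Game → Game → Game
A ⊸ B = (A *) ⊗ B

_∪ʳ_ : {X : Set} → Rel X 0ℓ → Rel X 0ℓ → Rel X 0ℓ
(R ∪ʳ S) x y = R x y ⊎ S x y

-- Strategy on a game A: a partial order ≤σ on M_A with polarity and acyclicity
IsStrategy : (A : Game) → Rel (M A) 0ℓ → Set
IsStrategy A σ =
  IsPartialOrder _≡_ σ
  × (∀ m n → Strict σ m n → pol A m ≡ O × pol A n ≡ P)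
  × IsPartialOrder _≡_ (TransClosure (σ ∪ʳ _≤_ A))

module _ (A B C : Game) where
  M3 : Set
  M3 = M A ⊎ (M B ⊎ M C)

  ιAB : M A ⊎ M B → M3
  ιAB (inj₁ a) = inj₁ a
  ιAB (inj₂ b) = inj₂ (inj₁ b)

  ιBC : M B ⊎ M C → M3
  ιBC (inj₁ b) = inj₂ (inj₁ b)
  ιBC (inj₂ c) = inj₂ (inj₂ c)

  ιAC : M A ⊎ M C → M3
  ιAC (inj₁ a) = inj₁ a
  ιAC (inj₂ c) = inj₂ (inj₂ c)

  unionST : Rel (M A ⊎ M B) 0ℓ → Rel (M B ⊎ M C) 0ℓ → Rel M3 0ℓ
  unionST σ τ x y =
    (∃₂ λ p q → ιAB p ≡ x × ιAB q ≡ y × σ p q)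
    ⊎ (∃₂ λ p q → ιBC p ≡ x × ιBC q ≡ y × τ p q)

  compose : Rel (M A ⊎ M B) 0ℓ → Rel (M B ⊎ M C) 0ℓ → Rel (M A ⊎ M C) 0ℓ
  compose σ τ x y = TransClosure (unionST σ τ) (ιAC x) (ιAC y)

module Submission where

-- Write M₃ = M_A ⊎ M_B ⊎ M_C and let S_σ, S_τ be the images in M₃ of the
-- acyclic closures (σ ∪ ≤_{A⊸B})⁺ and (τ ∪ ≤_{B⊸C})⁺.  Both are partial
-- orders, and a path alternating between them can only change side at a move
-- of B.  Since ≤_B is total, acyclicity of σ forces S_σ to agree with ≤_B on
-- moves of B (and likewise for τ), so the B-moves met along any path form an
-- ≤_B-increasing chain.  The abstract module Gluing shows that these facts
-- alone make the transitive closure of S_σ ∪ S_τ antisymmetric: every path is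
-- either one S-step or an S-step into B, a ≤_B-step and an S-step out of B,
-- and a cycle of this shape collapses.  The closure of ≤_σ ∪ ≤_τ, as well as
-- that of (τ∘σ) ∪ ≤_{A⊸C}, maps into these paths, which gives antisymmetry of
-- τ∘σ and acyclicity; reflexivity and transitivity are immediate.  Polarity
-- holds because σ and τ never place a Proponent move strictly below another
-- move (nor an Opponent move strictly above one), so a path of τ∘σ from a
-- Proponent move of A⊸C cannot leave it.

open import Defs
open import Level using (0ℓ)
open import Data.Empty using (⊥; ⊥-elim)
open import Data.Product using (∃; ∃₂; _×_; _,_; proj₁; proj₂)
open import Data.Sum using (_⊎_; inj₁; inj₂)
open import Function.Definitions using (Injective)
open import Relation.Nullary using (¬_)
open import Relation.Nullary.Negation using (¬¬-map)
open import Relation.Binary.Core using (Rel)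
open import Relation.Binary.Definitions using (Reflexive; Transitive; Antisymmetric; Total)
open import Relation.Binary.Structures using (IsPartialOrder)
open import Relation.Binary.PropositionalEquality using (_≡_; refl; sym; trans; cong; isEquivalence)
open import Relation.Binary.Construct.Closure.Transitive using (TransClosure; [_]; _∷_; _++_; _∷ʳ_)

isPartialOrder-≡ : {X : Set} {R : Rel X 0ℓ} →
  Reflexive R → Transitive R → Antisymmetric _≡_ R → IsPartialOrder _≡_ R
isPartialOrder-≡ r t a = record
  { isPreorder = record
    { isEquivalence = isEquivalence
    ; reflexive = λ { refl → r }
    ; trans = t }
  ; antisym = a }

closure-map : {X Y : Set} {R : Rel X 0ℓ} {S : Rel Y 0ℓ} (f : X → Y) →
  (∀ {x y} → R x y → TransClosure S (f x) (f y)) →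
  ∀ {x y} → TransClosure R x y → TransClosure S (f x) (f y)
closure-map f step [ r ] = step r
closure-map f step (r ∷ rs) = step r ++ closure-map f step rs

stuck-source : {X : Set} {R : Rel X 0ℓ} (Q : X → Set) →
  (∀ {x y} → Q x → R x y → ¬ ¬ (x ≡ y)) →
  ∀ {x y} → Q x → TransClosure R x y → ¬ ¬ (x ≡ y)
stuck-source Q stuck qx [ r ] = stuck qx r
stuck-source Q stuck qx (r ∷ rs) x≢y =
  stuck qx r λ { refl → stuck-source Q stuck qx rs x≢y }

stuck-target : {X : Set} {R : Rel X 0ℓ} (Q : X → Set) →
  (∀ {x y} → Q y → R x y → ¬ ¬ (x ≡ y)) →
  ∀ {x y} → Q y → TransClosure R x y → ¬ ¬ (x ≡ y)
stuck-target Q stuck qy [ r ] = stuck qy r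
stuck-target Q stuck qy (r ∷ rs) x≢y =
  stuck-target Q stuck qy rs λ { refl → stuck qy r x≢y }

closure-within-total : {X : Set} {R Q : Rel X 0ℓ} →
  Antisymmetric _≡_ (TransClosure (R ∪ʳ Q)) →
  ∀ {x y} → Q x x → Q x y ⊎ Q y x → TransClosure (R ∪ʳ Q) x y → Q x y
closure-within-total antisym qxx (inj₁ qxy) t = qxy
closure-within-total antisym qxx (inj₂ qyx) t with antisym t [ inj₂ qyx ]
... | refl = qxx

Image : {P X : Set} → (P → X) → Rel P 0ℓ → Rel X 0ℓ
Image f R x y = ∃₂ λ p q → f p ≡ x × f q ≡ y × R p q

image-map : {P X : Set} {f : P → X} {R R′ : Rel P 0ℓ} →
  (∀ {p q} → R p q → R′ p q) → ∀ {x y} → Image f R x y → Image f R′ x y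
image-map g (p , q , ep , eq , r) = p , q , ep , eq , g r

image-trans : {P X : Set} {f : P → X} {R : Rel P 0ℓ} →
  Injective _≡_ _≡_ f → Transitive R → Transitive (Image f R)
image-trans f-inj R-trans (p , q , ep , refl , r) (q′ , s , eq′ , es , r′)
  with f-inj eq′
... | refl = p , s , ep , es , R-trans r r′

image-antisym : {P X : Set} {f : P → X} {R : Rel P 0ℓ} →
  Injective _≡_ _≡_ f → Antisymmetric _≡_ R → Antisymmetric _≡_ (Image f R)
image-antisym {f = f} f-inj R-antisym (p , q , refl , refl , r) (q′ , p′ , eq′ , ep′ , r′)
  with f-inj eq′ | f-inj ep′
... | refl | refl = cong f (R-antisym r r′)

PolarityCondition : (G : Game) → Rel (M G) 0ℓ → Set
PolarityCondition G σ = ∀ m n → Strict σ m n → pol G m ≡ O × pol G n ≡ P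

O≢P : ¬ (O ≡ P)
O≢P ()

not-P⇒O : ∀ {p} → ¬ (p ≡ P) → p ≡ O
not-P⇒O {O} _ = refl
not-P⇒O {P} p≢P = ⊥-elim (p≢P refl)

not-O⇒P : ∀ {p} → ¬ (p ≡ O) → p ≡ P
not-O⇒P {O} p≢O = ⊥-elim (p≢O refl)
not-O⇒P {P} _ = refl

proponent-minimal : ∀ {G σ} → PolarityCondition G σ →
  ∀ {m n} → pol G m ≡ P → σ m n → ¬ ¬ (m ≡ n)
proponent-minimal polarity pm r m≢n =
  O≢P (trans (sym (proj₁ (polarity _ _ (r , m≢n)))) pm)

opponent-maximal : ∀ {G σ} → PolarityCondition G σ →
  ∀ {m n} → pol G n ≡ O → σ m n → ¬ ¬ (m ≡ n)
opponent-maximal polarity on r m≢n =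
  O≢P (trans (sym on) (proj₂ (polarity _ _ (r , m≢n))))

data Side : Set where
  left right : Side

other : Side → Side
other left = right
other right = left

-- Gluing two antisymmetric transitive relations S left, S right on X along a
-- partial order ≼ on Y embedded by β: if both relations are monotone on the
-- image of β and a path can only change side inside that image, then paths
-- alternating between the two sides still form an antisymmetric relation.
module Gluing {X Y : Set} (β : Y → X) {_≼_ : Rel Y 0ℓ} (≼-po : IsPartialOrder _≡_ _≼_)
  (S : Side → Rel X 0ℓ)
  (S-trans : ∀ k → Transitive (S k))
  (S-antisym : ∀ k → Antisymmetric _≡_ (S k))
  (S-monotone : ∀ k {u v} → S k (β u) (β v) → u ≼ v)
  (S-switch : ∀ k {x y z} → S k x y → S (other k) y z → ∃ λ b → y ≡ β b)
  where

  private
    module ≼ = IsPartialOrder ≼-po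

  Step : Rel X 0ℓ
  Step x y = ∃ λ k → S k x y

  Path : Rel X 0ℓ
  Path = TransClosure Step

  S-switch′ : ∀ k {x y z} → S (other k) x y → S k y z → ∃ λ b → y ≡ β b
  S-switch′ left = S-switch right
  S-switch′ right = S-switch left

  join : ∀ k k′ {x y z} → S k x y → S k′ y z → S k x z ⊎ ∃ λ b → y ≡ β b
  join left left s s′ = inj₁ (S-trans left s s′)
  join right right s s′ = inj₁ (S-trans right s s′)
  join left right s s′ = inj₂ (S-switch left s s′)
  join right left s s′ = inj₂ (S-switch right s s′)

  data Normal (x y : X) : Set where
    direct : ∀ {k} → S k x y → Normal x y
    through : ∀ {k k′ b b′} → S k x (β b) → b ≼ b′ → S k′ (β b′) y → Normal x y

  cons : ∀ {x y z} → Step x y → Normal y z → Normal x z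
  cons (k , s) (direct {k′} s′) with join k k′ s s′
  ... | inj₁ s″ = direct s″
  ... | inj₂ (c , refl) = through s ≼.refl s′
  cons (k , s) (through {k₁} s₁ b≼b′ s₂) with join k k₁ s s₁
  ... | inj₁ s′ = through s′ b≼b′ s₂
  ... | inj₂ (c , refl) = through s (≼.trans (S-monotone k₁ s₁) b≼b′) s₂

  normalise : ∀ {x y} → Path x y → Normal x y
  normalise [ (k , s) ] = direct s
  normalise (s ∷ p) = cons s (normalise p)

  path-monotone : ∀ {u v} → Path (β u) (β v) → u ≼ v
  path-monotone p with normalise p
  ... | direct {k} s = S-monotone k s
  ... | through {k} {k′} s b≼b′ s′ =
    ≼.trans (S-monotone k s) (≼.trans b≼b′ (S-monotone k′ s′))

  crossing-cycle : ∀ k {x y} → S k x y → S (other k) y x → x ≡ y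
  crossing-cycle k s s′ with S-switch k s s′ | S-switch′ k s′ s
  ... | (c , refl) | (d , refl) =
    cong β (≼.antisym (S-monotone k s) (S-monotone (other k) s′))

  -- A two-step cycle collapses: by antisymmetry on one side, and otherwise
  -- because both its points lie in β and are ≼-related both ways.
  two-cycle : ∀ {k k′ x y} → S k x y → S k′ y x → x ≡ y
  two-cycle {left} {left} = S-antisym left
  two-cycle {right} {right} = S-antisym right
  two-cycle {left} {right} = crossing-cycle left
  two-cycle {right} {left} = crossing-cycle right

  three-cycle : ∀ {k₁ k k₂ b x y} →
    S k₁ (β b) x → S k x y → S k₂ y (β b) → x ≡ y
  three-cycle {k₁} {k} s₁ s s₂ with join k₁ k s₁ s
  ... | inj₁ t with two-cycle t s₂
  ...   | refl = two-cycle s s₁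
  three-cycle {k₁} s₁ s s₂ | inj₂ (d , refl)
    with ≼.antisym (S-monotone k₁ s₁) (path-monotone ((_ , s) ∷ [ (_ , s₂) ]))
  ... | refl = two-cycle s s₂

  -- A cycle made of a step followed by a path collapses: its normal form
  -- makes it a two- or three-step cycle.
  step-cycle : ∀ {k x y} → S k x y → Path y x → x ≡ y
  step-cycle s p with normalise p
  ... | direct s′ = two-cycle s s′
  ... | through s₁ b≼b′ s₂
    with ≼.antisym b≼b′ (path-monotone ((_ , s₂) ∷ (_ , s) ∷ [ (_ , s₁) ]))
  ...   | refl = three-cycle s₂ s s₁

  path-antisym : Antisymmetric _≡_ Path
  path-antisym p q with normalise p
  ... | direct s = step-cycle s q
  ... | through s b≼b′ s′
    with ≼.antisym b≼b′ (path-monotone ((_ , s′) ∷ (q ∷ʳ (_ , s))))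
  ...   | refl = trans (step-cycle s ((_ , s′) ∷ q)) (step-cycle s′ (q ∷ʳ (_ , s)))

module Composition (A B C : Game)
  (≤B-po : IsPartialOrder _≡_ (_≤_ B)) (≤B-total : Total (_≤_ B))
  (σ : Rel (M (A ⊸ B)) 0ℓ) (σ-strategy : IsStrategy (A ⊸ B) σ)
  (τ : Rel (M (B ⊸ C)) 0ℓ) (τ-strategy : IsStrategy (B ⊸ C) τ) where

  private
    module ≤B = IsPartialOrder ≤B-po

  M₃ : Set
  M₃ = M3 A B C

  embAB : M A ⊎ M B → M₃
  embAB = ιAB A B C

  embBC : M B ⊎ M C → M₃
  embBC = ιBC A B C

  embAC : M A ⊎ M C → M₃
  embAC = ιAC A B C

  embB : M B → M₃
  embB b = inj₂ (inj₁ b)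

  embAB-injective : Injective _≡_ _≡_ embAB
  embAB-injective {inj₁ _} {inj₁ _} refl = refl
  embAB-injective {inj₂ _} {inj₂ _} refl = refl

  embBC-injective : Injective _≡_ _≡_ embBC
  embBC-injective {inj₁ _} {inj₁ _} refl = refl
  embBC-injective {inj₂ _} {inj₂ _} refl = refl

  embAC-injective : Injective _≡_ _≡_ embAC
  embAC-injective {inj₁ _} {inj₁ _} refl = refl
  embAC-injective {inj₂ _} {inj₂ _} refl = refl

  shared-move : ∀ p q → embAB p ≡ embBC q → ∃ λ b → embBC q ≡ embB b
  shared-move (inj₂ b) (inj₁ .b) refl = b , refl
  shared-move (inj₁ _) (inj₁ _) ()
  shared-move (inj₁ _) (inj₂ _) ()
  shared-move (inj₂ _) (inj₂ _) ()

  Tσ : Rel (M (A ⊸ B)) 0ℓ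
  Tσ = TransClosure (σ ∪ʳ _≤_ (A ⊸ B))

  Tτ : Rel (M (B ⊸ C)) 0ℓ
  Tτ = TransClosure (τ ∪ʳ _≤_ (B ⊸ C))

  private
    module Tσ = IsPartialOrder (proj₂ (proj₂ σ-strategy))
    module Tτ = IsPartialOrder (proj₂ (proj₂ τ-strategy))

  S : Side → Rel M₃ 0ℓ
  S left = Image embAB Tσ
  S right = Image embBC Tτ

  S-trans : ∀ k → Transitive (S k)
  S-trans left = image-trans embAB-injective Tσ.trans
  S-trans right = image-trans embBC-injective Tτ.trans

  S-antisym : ∀ k → Antisymmetric _≡_ (S k)
  S-antisym left = image-antisym embAB-injective Tσ.antisym
  S-antisym right = image-antisym embBC-injective Tτ.antisym

  S-monotone : ∀ k {u v} → S k (embB u) (embB v) → _≤_ B u v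
  S-monotone left (inj₂ u , inj₂ v , refl , refl , t) =
    closure-within-total Tσ.antisym ≤B.refl (≤B-total u v) t
  S-monotone left (inj₁ _ , _ , () , _)
  S-monotone left (inj₂ _ , inj₁ _ , _ , () , _)
  S-monotone right (inj₁ u , inj₁ v , refl , refl , t) =
    closure-within-total Tτ.antisym ≤B.refl (≤B-total u v) t
  S-monotone right (inj₂ _ , _ , () , _)
  S-monotone right (inj₁ _ , inj₂ _ , _ , () , _)

  S-switch : ∀ k {x y z} → S k x y → S (other k) y z → ∃ λ b → y ≡ embB b
  S-switch left (_ , q , _ , refl , _) (p′ , _ , ep′ , _) with shared-move q p′ (sym ep′)
  ... | (b , e) = b , trans (sym ep′) e
  S-switch right (_ , q , _ , refl , _) (p′ , _ , ep′ , _) = shared-move p′ q ep′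

  open Gluing embB ≤B-po S S-trans S-antisym S-monotone S-switch

  compose-step : ∀ {x y} → unionST A B C σ τ x y → Step x y
  compose-step (inj₁ s) = left , image-map (λ r → [ inj₁ r ]) s
  compose-step (inj₂ s) = right , image-map (λ r → [ inj₁ r ]) s

  τ∘σ : Rel (M (A ⊸ C)) 0ℓ
  τ∘σ = compose A B C σ τ

  Acyclic : Rel (M (A ⊸ C)) 0ℓ
  Acyclic = TransClosure (τ∘σ ∪ʳ _≤_ (A ⊸ C))

  acyclic-step : ∀ {x y} → (τ∘σ ∪ʳ _≤_ (A ⊸ C)) x y → Path (embAC x) (embAC y)
  acyclic-step (inj₁ c) = closure-map (λ z → z) (λ u → [ compose-step u ]) c
  acyclic-step {inj₁ a} {inj₁ a′} (inj₂ le) =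
    [ left , inj₁ a , inj₁ a′ , refl , refl , [ inj₂ le ] ]
  acyclic-step {inj₂ c} {inj₂ c′} (inj₂ le) =
    [ right , inj₂ c , inj₂ c′ , refl , refl , [ inj₂ le ] ]
  acyclic-step {inj₁ _} {inj₂ _} (inj₂ ())
  acyclic-step {inj₂ _} {inj₁ _} (inj₂ ())

  acyclic-antisym : Antisymmetric _≡_ Acyclic
  acyclic-antisym p q =
    embAC-injective (path-antisym (closure-map embAC acyclic-step p)
                                  (closure-map embAC acyclic-step q))

  -- τ∘σ is reflexive since σ is, and antisymmetric since it is contained
  -- in its acyclic closure.
  compose-refl : Reflexive τ∘σ
  compose-refl {inj₁ a} =
    [ inj₁ (inj₁ a , inj₁ a , refl , refl , IsPartialOrder.refl (proj₁ σ-strategy)) ]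
  compose-refl {inj₂ c} =
    [ inj₂ (inj₂ c , inj₂ c , refl , refl , IsPartialOrder.refl (proj₁ τ-strategy)) ]

  compose-antisym : Antisymmetric _≡_ τ∘σ
  compose-antisym c d = acyclic-antisym [ inj₁ c ] [ inj₁ d ]

  acyclic-refl : Reflexive Acyclic
  acyclic-refl = [ inj₁ compose-refl ]

  HasPolarity : Pol → M₃ → Set
  HasPolarity p (inj₁ a) = neg (pol A a) ≡ p
  HasPolarity p (inj₂ (inj₁ b)) = ⊥
  HasPolarity p (inj₂ (inj₂ c)) = pol C c ≡ p

  polarity-AC : ∀ {p} x → pol (A ⊸ C) x ≡ p → HasPolarity p (embAC x)
  polarity-AC (inj₁ _) e = e
  polarity-AC (inj₂ _) e = e

  polarity-AB : ∀ {p} m → HasPolarity p (embAB m) → pol (A ⊸ B) m ≡ p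
  polarity-AB (inj₁ _) e = e

  polarity-BC : ∀ {p} m → HasPolarity p (embBC m) → pol (B ⊸ C) m ≡ p
  polarity-BC (inj₂ _) e = e

  private
    σ-polarity = proj₁ (proj₂ σ-strategy)
    τ-polarity = proj₁ (proj₂ τ-strategy)

  proponent-stuck : ∀ {x y} → HasPolarity P x → unionST A B C σ τ x y → ¬ ¬ (x ≡ y)
  proponent-stuck px (inj₁ (m , _ , refl , refl , r)) =
    ¬¬-map (cong embAB) (proponent-minimal {A ⊸ B} σ-polarity (polarity-AB m px) r)
  proponent-stuck px (inj₂ (m , _ , refl , refl , r)) =
    ¬¬-map (cong embBC) (proponent-minimal {B ⊸ C} τ-polarity (polarity-BC m px) r)

  opponent-stuck : ∀ {x y} → HasPolarity O y → unionST A B C σ τ x y → ¬ ¬ (x ≡ y)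
  opponent-stuck oy (inj₁ (_ , n , refl , refl , r)) =
    ¬¬-map (cong embAB) (opponent-maximal {A ⊸ B} σ-polarity (polarity-AB n oy) r)
  opponent-stuck oy (inj₂ (_ , n , refl , refl , r)) =
    ¬¬-map (cong embBC) (opponent-maximal {B ⊸ C} τ-polarity (polarity-BC n oy) r)

  compose-polarity : PolarityCondition (A ⊸ C) τ∘σ
  compose-polarity m n (c , m≢n) =
      not-P⇒O (λ pm → stuck-source (HasPolarity P) proponent-stuck
                        (polarity-AC m pm) c distinct)
    , not-O⇒P (λ on → stuck-target (HasPolarity O) opponent-stuck
                        (polarity-AC n on) c distinct)
    where
    distinct : ¬ (embAC m ≡ embAC n)
    distinct e = m≢n (embAC-injective e)

mainTheorem6 : (A B C : Game)
    → IsGame A → Finite A → Filiform A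
    → IsGame B → Finite B → Filiform B
    → IsGame C → Finite C → Filiform C
    → (σ : Rel (M (A ⊸ B)) 0ℓ) → IsStrategy (A ⊸ B) σ
    → (τ : Rel (M (B ⊸ C)) 0ℓ) → IsStrategy (B ⊸ C) τ
    → IsStrategy (A ⊸ C) (compose A B C σ τ)
mainTheorem6 A B C _ _ _ (≤B-po , _) _ ≤B-total _ _ _ σ σ-strategy τ τ-strategy =
    isPartialOrder-≡ compose-refl _++_ compose-antisym
  , compose-polarity
  , isPartialOrder-≡ acyclic-refl _++_ acyclic-antisym
  where open Composition A B C ≤B-po ≤B-total σ σ-strategy τ τ-strategy
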